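{- Let $n>2$. The number of literals in the expression produced by the one-vertex decomposition algorithm (1-VDA) for a trapezoidal dipterous square rhomboid of size $n$ (i.e. in $E(\overline{p},\overline{p+n})$ or $E(\underline{p},\underline{p+n})$) equals the number of literals in the expression produced by 1-VDA for a parallelogram dipterous square rhomboid of size $n$ (i.e. in $E(\underline{p},\overline{p+n})$ or $E(\overline{p},\underline{p+n})$).
   Context: Square rhomboid. For an integer $n\ge 1$, the square rhomboid $SR(n)$ is the directed acyclic graph with basic vertices $1,\dots,n$, upper vertices $\overline{1},\dots,\overline{n-1}$ and lower vertices $\underline{1},\dots,\underline{n-1}$, and the following labeled edges (all labels are distinct literals): for $1\le v\le n-1$: $b_v:v\to v+1$, $e_{2v-1}:v\to\overline{v}$, $e_{2v}:\overline{v}\to v+1$, $d_{2v-1}:v\to\underline{v}$, $d_{2v}:\underline{v}\to v+1$; for $1\le v\le n-2$: $c_v:\overline{v}\to\overline{v+1}$ and $a_v:\underline{v}\to\underline{v+1}$. For vertices $x,y$ of a sufficiently large square rhomboid, the subgraph from $x$ to $y$ consists of all vertices and edges lying on directed paths from $x$ to $y$; its canonical expression is the sum, over all directed $x$–$y$ paths, of the product of the edge labels along the path. An expression of this subgraph is any expression built from the literals with $+$ and $\cdot$ that is algebraically equivalent to the canonical expression; its complexity is its total number of literal occurrences. Kinds of subgraphs: the subgraph from $p$ to $q$ ($p\le q$) is a square rhomboid of size $q-p+1$. The subgraphs from $p$ to $\overline{q}$ or to $\underline{q}$ ($p\le q$) are single-leaf square rhomboids of size $q-p+1$; those from $\overline{p}$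 or $\underline{p}$ to $q$ ($p<q$) are single-leaf square rhomboids of size $q-p$. The subgraphs from $\overline{p}$ to $\overline{q}$ and from $\underline{p}$ to $\underline{q}$ ($p<q$) are trapezoidal dipterous square rhomboids of size $q-p$; those from $\underline{p}$ to $\overline{q}$ and from $\overline{p}$ to $\underline{q}$ ($p<q$) are parallelogram dipterous square rhomboids of size $q-p$. 1-VDA defines a formal expression $E(x,y)$ for each such subgraph by the rules: 1. $E(p,p)=1$; 2. $E(p,\overline{p})=e_{2p-1}$; 3. $E(p,\underline{p})=d_{2p-1}$; 4. $E(\overline{p},p+1)=e_{2p}$; 5. $E(\underline{p},p+1)=d_{2p}$; 6. $E(\overline{p},\overline{p+1})=c_p+e_{2p}e_{2p+1}$; 7. $E(\overline{p},\underline{p+1})=e_{2p}d_{2p+1}$; 8. $E(\underline{p},\overline{p+1})=d_{2p}e_{2p+1}$; 9. $E(\underline{p},\underline{p+1})=a_p+d_{2p}d_{2p+1}$; 10. $E(p,p+1)=b_p+e_{2p-1}e_{2p}+d_{2p-1}d_{2p}$; 11. $E(p,\overline{p+1})=(b_p+d_{2p-1}d_{2p})e_{2p+1}+e_{2p-1}(c_p+e_{2p}e_{2p+1})$; 12. $E(p,\underline{p+1})=(b_p+e_{2p-1}e_{2p})d_{2p+1}+d_{2p-1}(a_p+d_{2p}d_{2p+1})$; 13. $E(\overline{p},p+2)=(c_p+e_{2p}e_{2p+1})e_{2p+2}+e_{2p}(b_{p+1}+d_{2p+1}d_{2p+2})$; 14. $E(\underline{p},p+2)=(a_p+d_{2p}d_{2p+1})d_{2p+2}+d_{2p}(b_{p+1}+e_{2p+1}e_{2p+2})$;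 15. $E(\overline{p},\overline{p+2})=e_{2p}(b_{p+1}+d_{2p+1}d_{2p+2})e_{2p+3}+(a_p+d_{2p}d_{2p+1})(a_{p+1}+d_{2p+2}d_{2p+3})$; 16. $E(\overline{p},\underline{p+2})=e_{2p}(b_{p+1}d_{2p+3}+d_{2p+1}(a_{p+1}+d_{2p+2}d_{2p+3}))+(c_p+e_{2p}e_{2p+1})e_{2p+2}d_{2p+3}$; 17. $E(\underline{p},\overline{p+2})=d_{2p}(b_{p+1}e_{2p+3}+e_{2p+1}(c_{p+1}+e_{2p+2}e_{2p+3}))+(a_p+d_{2p}d_{2p+1})d_{2p+2}e_{2p+3}$; 18. $E(\underline{p},\underline{p+2})=d_{2p}(b_{p+1}+e_{2p+1}e_{2p+2})d_{2p+3}+(c_p+e_{2p}e_{2p+1})(c_{p+1}+e_{2p+2}e_{2p+3})$. Otherwise, writing $x\in\{p,\overline{p},\underline{p}\}$ and $y\in\{q,\overline{q},\underline{q}\}$, $E(x,y)=E(x,i)E(i,y)+E(x,\overline{i-1})\,c_{i-1}\,E(\overline{i},y)+E(x,\underline{i-1})\,a_{i-1}\,E(\underline{i},y)$, where: for $x=p$, $y\in\{\overline{q},\underline{q}\}$, $q>p+1$: $i=\lceil (q+p)/2\rceil$; for $x\in\{\overline{p},\underline{p}\}$, $y=q$, $q>p+2$: $i=\lceil (q+p)/2\rceil$; for $x\in\{\overline{p},\underline{p}\}$, $y\in\{\overline{q},\underline{q}\}$, $q>p+2$: $i=(q+p+1)/2$ (rounded up or down when not an integer); for $x=p$, $y=q$,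 $q>p+1$: $i=(q+p)/2$ (rounded up or down when not an integer). -}

module Defs where

open import Data.Nat using (ℕ; zero; suc; _+_; _*_; _∸_; ⌊_/2⌋; ⌈_/2⌉)
open import Data.Bool using (Bool; true; false; if_then_else_)

-- Edge labels (literals) of the square rhomboid:
--   b v : v → v+1,  e (2v-1) : v → v̄,  e (2v) : v̄ → v+1,
--   d (2v-1) : v → v̲,  d (2v) : v̲ → v+1,  c v : v̄ → (v+1)̄,  a v : v̲ → (v+1)̲
data Lit : Set where
  b e d c a : ℕ → Lit

data Expr : Set where
  one  : Expr
  lit  : Lit → Expr
  _⊕_  : Expr → Expr → Expr
  _⊗_  : Expr → Expr → Expr

infixl 6 _⊕_
infixl 7 _⊗_

literals : Expr → ℕ
literals one       = 0
literals (lit _)   = 1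
literals (x ⊕ y)   = literals x + literals y
literals (x ⊗ y)   = literals x + literals y

-- kinds of vertices: basic v, upper v̄, lower v̲
data Kind : Set where
  basic upper lower : Kind

-- A rounding policy: whenever 1-VDA's split index is "rounded up or down
-- when not an integer", the policy decides (true = up) for the call
-- E(x_p , y_q) given by (kind x, p, kind y, q).
Policy : Set
Policy = Kind → ℕ → Kind → ℕ → Bool

half : Bool → ℕ → ℕ
half up t = if up then ⌈ t /2⌉ else ⌊ t /2⌋

private
  B E D C A : ℕ → Expr
  B j = lit (b j)
  E j = lit (e j)
  D j = lit (d j)
  C j = lit (c j)
  A j = lit (a j)

-- vda f x p y n  is 1-VDA's expression E(x_p , y_(p+n)), computed with
-- recursion fuel f (fuel  n+1  always suffices since every recursive call
-- strictly decreases n; the fallback 'one' is never reached then, nor is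
-- it reached for the subgraphs occurring in the statement).
vda : Policy → ℕ → Kind → ℕ → Kind → ℕ → Expr
vda pol zero _ _ _ _ = one
vda pol (suc f) x p y n = go x y n
  where
  -- the general rule with split vertex i = p + k
  split : ℕ → Expr
  split k =
      vda pol f x p basic k ⊗ vda pol f basic (p + k) y (n ∸ k)
    ⊕ vda pol f x p upper (k ∸ 1) ⊗ C (p + k ∸ 1) ⊗ vda pol f upper (p + k) y (n ∸ k)
    ⊕ vda pol f x p lower (k ∸ 1) ⊗ A (p + k ∸ 1) ⊗ vda pol f lower (p + k) y (n ∸ k)
  go : Kind → Kind → ℕ → Expr
  -- rules 1, 10, and the general rule (x = p, y = q, q > p+1; i = (q+p)/2 rounded)
  go basic basic zero = one
  go basic basic (suc zero) = B p ⊕ E (2 * p ∸ 1) ⊗ E (2 * p) ⊕ D (2 * p ∸ 1) ⊗ D (2 * p)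
  go basic basic m@(suc (suc _)) = split (half (pol basic p basic (p + n)) m)
  -- rules 2, 11, and the general rule (i = ⌈(q+p)/2⌉)
  go basic upper zero = E (2 * p ∸ 1)
  go basic upper (suc zero) =
    (B p ⊕ D (2 * p ∸ 1) ⊗ D (2 * p)) ⊗ E (2 * p + 1) ⊕ E (2 * p ∸ 1) ⊗ (C p ⊕ E (2 * p) ⊗ E (2 * p + 1))
  go basic upper m@(suc (suc _)) = split ⌈ m /2⌉
  go basic lower zero = D (2 * p ∸ 1)
  go basic lower (suc zero) =
    (B p ⊕ E (2 * p ∸ 1) ⊗ E (2 * p)) ⊗ D (2 * p + 1) ⊕ D (2 * p ∸ 1) ⊗ (A p ⊕ D (2 * p) ⊗ D (2 * p + 1))
  go basic lower m@(suc (suc _)) = split ⌈ m /2⌉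
  -- rules 4, 13, and the general rule (q > p+2, i = ⌈(q+p)/2⌉)
  go upper basic zero = one -- not a valid subgraph
  go upper basic (suc zero) = E (2 * p)
  go upper basic (suc (suc zero)) =
    (C p ⊕ E (2 * p) ⊗ E (2 * p + 1)) ⊗ E (2 * p + 2) ⊕ E (2 * p) ⊗ (B (p + 1) ⊕ D (2 * p + 1) ⊗ D (2 * p + 2))
  go upper basic m@(suc (suc (suc _))) = split ⌈ m /2⌉
  go lower basic zero = one -- not a valid subgraph
  go lower basic (suc zero) = D (2 * p)
  go lower basic (suc (suc zero)) =
    (A p ⊕ D (2 * p) ⊗ D (2 * p + 1)) ⊗ D (2 * p + 2) ⊕ D (2 * p) ⊗ (B (p + 1) ⊕ E (2 * p + 1) ⊗ E (2 * p + 2))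
  go lower basic m@(suc (suc (suc _))) = split ⌈ m /2⌉
  -- rules 6, 15, and the general rule (q > p+2, i = (q+p+1)/2 rounded)
  go upper upper zero = one -- not a valid subgraph
  go upper upper (suc zero) = C p ⊕ E (2 * p) ⊗ E (2 * p + 1)
  go upper upper (suc (suc zero)) =
    E (2 * p) ⊗ (B (p + 1) ⊕ D (2 * p + 1) ⊗ D (2 * p + 2)) ⊗ E (2 * p + 3)
    ⊕ (A p ⊕ D (2 * p) ⊗ D (2 * p + 1)) ⊗ (A (p + 1) ⊕ D (2 * p + 2) ⊗ D (2 * p + 3))
  go upper upper m@(suc (suc (suc _))) = split (half (pol upper p upper (p + n)) (suc m))
  go upper lower zero = one -- not a valid subgraph
  go upper lower (suc zero) = E (2 * p) ⊗ D (2 * p + 1)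
  go upper lower (suc (suc zero)) =
    E (2 * p) ⊗ (B (p + 1) ⊗ D (2 * p + 3) ⊕ D (2 * p + 1) ⊗ (A (p + 1) ⊕ D (2 * p + 2) ⊗ D (2 * p + 3)))
    ⊕ (C p ⊕ E (2 * p) ⊗ E (2 * p + 1)) ⊗ E (2 * p + 2) ⊗ D (2 * p + 3)
  go upper lower m@(suc (suc (suc _))) = split (half (pol upper p lower (p + n)) (suc m))
  go lower upper zero = one -- not a valid subgraph
  go lower upper (suc zero) = D (2 * p) ⊗ E (2 * p + 1)
  go lower upper (suc (suc zero)) =
    D (2 * p) ⊗ (B (p + 1) ⊗ E (2 * p + 3) ⊕ E (2 * p + 1) ⊗ (C (p + 1) ⊕ E (2 * p + 2) ⊗ E (2 * p + 3)))
    ⊕ (A p ⊕ D (2 * p) ⊗ D (2 * p + 1)) ⊗ D (2 * p + 2) ⊗ E (2 * p + 3)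
  go lower upper m@(suc (suc (suc _))) = split (half (pol lower p upper (p + n)) (suc m))
  go lower lower zero = one -- not a valid subgraph
  go lower lower (suc zero) = A p ⊕ D (2 * p) ⊗ D (2 * p + 1)
  go lower lower (suc (suc zero)) =
    D (2 * p) ⊗ (B (p + 1) ⊕ E (2 * p + 1) ⊗ E (2 * p + 2)) ⊗ D (2 * p + 3)
    ⊕ (C p ⊕ E (2 * p) ⊗ E (2 * p + 1)) ⊗ (C (p + 1) ⊕ E (2 * p + 2) ⊗ E (2 * p + 3))
  go lower lower m@(suc (suc (suc _))) = split (half (pol lower p lower (p + n)) (suc m))

VDA : Policy → Kind → ℕ → Kind → ℕ → Expr
VDA pol x p y n = vda pol (suc n) x p y n

module Submission where

open import Defs
open import Data.Nat using (ℕ; zero; suc; _+_; _∸_; _<_; _≤_; s≤s; ⌊_/2⌋; ⌈_/2⌉)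
open import Data.Nat.Properties using (⌊n/2⌋+⌈n/2⌉≡n; +-comm; +-suc; m+n∸m≡n)
open import Data.Nat.Tactic.RingSolver using (solve-∀)
open import Data.Bool using (true; false)
open import Data.Product using (_×_; _,_)
open import Relation.Binary.PropositionalEquality using (_≡_; refl; sym; trans; cong)

-- The number of literals in a 1-VDA expression E(x,y) depends
-- only on the shape of the subgraph from x to y (full, single-leaf,
-- trapezoidal or parallelogram dipterous rhomboid) and on its size, and
-- neither on the index p nor on the rounding choices.  We define these
-- shape-wise counts  full, leaf, trap, para  by mutual recursion on a fuel
-- parameter matching that of 'vda'; in them the split of a dipterous
-- rhomboid of size > 2 is counted by the same function  dipSplit  for both
-- dipterous shapes, because such a split always produces one single-leaf
-- piece, one trapezoidal and one parallelogram piece on each side.  The theorem is then the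
-- definitional equality  trap (suc f) (3 + r) = para (suc f) (3 + r).

-- Literal count of the general rule
--   E(x,i) E(i,y) + E(x,ī-1) c E(ī,y) + E(x,i̲-1) a E(i̲,y)
-- from the counts of its six sub-expressions (the two 1s count the literals c and a).
splitCount : ℕ → ℕ → ℕ → ℕ → ℕ → ℕ → ℕ
splitCount l₁ r₁ l₂ r₂ l₃ r₃ = (l₁ + r₁) + (l₂ + 1 + r₂) + (l₃ + 1 + r₃)

splitCount-reverse : ∀ l₁ r₁ l₂ r₂ l₃ r₃ →
  splitCount l₁ r₁ l₂ r₂ l₃ r₃ ≡ splitCount r₁ l₁ r₂ l₂ r₃ l₃
splitCount-reverse = normalised
  where
  normalised : ∀ l₁ r₁ l₂ r₂ l₃ r₃ →
    (l₁ + r₁) + (l₂ + 1 + r₂) + (l₃ + 1 + r₃) ≡ (r₁ + l₁) + (r₂ + 1 + l₂) + (r₃ + 1 + l₃)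
  normalised = solve-∀

splitCount-swapRoutes : ∀ l₁ r₁ l₂ r₂ l₃ r₃ →
  splitCount l₁ r₁ l₂ r₂ l₃ r₃ ≡ splitCount l₁ r₁ l₃ r₃ l₂ r₂
splitCount-swapRoutes = normalised
  where
  normalised : ∀ l₁ r₁ l₂ r₂ l₃ r₃ →
    (l₁ + r₁) + (l₂ + 1 + r₂) + (l₃ + 1 + r₃) ≡ (l₁ + r₁) + (l₃ + 1 + r₃) + (l₂ + 1 + r₂)
  normalised = solve-∀

splitCount-crossRoutes : ∀ l₁ r₁ l₂ r₂ l₃ r₃ →
  splitCount l₁ r₁ l₂ r₂ l₃ r₃ ≡ splitCount l₁ r₁ l₂ r₃ l₃ r₂
splitCount-crossRoutes = normalised
  where
  normalised : ∀ l₁ r₁ l₂ r₂ l₃ r₃ →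
    (l₁ + r₁) + (l₂ + 1 + r₂) + (l₃ + 1 + r₃) ≡ (l₁ + r₁) + (l₂ + 1 + r₃) + (l₃ + 1 + r₂)
  normalised = solve-∀

-- Shape-wise literal counts, with fuel f as in 'vda', as functions of the
-- index distance n between the end vertices:
--   full f n  for E(p, p+n);      leaf f n  for E(p, (p+n)‾) and E(p̄, p+n+1);
--   trap f n  for E(p̄, (p+n)‾);   para f n  for E(p̲, (p+n)‾).
-- fullSplit, leafSplit and dipSplit count the general rule with halves u, v.
mutual
  full : ℕ → ℕ → ℕ
  full zero    _             = 0
  full (suc f) zero          = 0
  full (suc f) (suc zero)    = 5
  full (suc f) (suc (suc r)) = fullSplit f ⌈ r /2⌉ ⌊ r /2⌋

  leaf : ℕ → ℕ → ℕ
  leaf zero    _             = 0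
  leaf (suc f) zero          = 1
  leaf (suc f) (suc zero)    = 8
  leaf (suc f) (suc (suc r)) = leafSplit f ⌈ r /2⌉ ⌊ r /2⌋

  trap : ℕ → ℕ → ℕ
  trap zero    _                   = 0
  trap (suc f) zero                = 0
  trap (suc f) (suc zero)          = 3
  trap (suc f) (suc (suc zero))    = 11
  trap (suc f) (suc (suc (suc r))) = dipSplit f ⌈ r /2⌉ ⌊ r /2⌋

  para : ℕ → ℕ → ℕ
  para zero    _                   = 0
  para (suc f) zero                = 0
  para (suc f) (suc zero)          = 2
  para (suc f) (suc (suc zero))    = 12
  para (suc f) (suc (suc (suc r))) = dipSplit f ⌈ r /2⌉ ⌊ r /2⌋

  fullSplit : ℕ → ℕ → ℕ → ℕ
  fullSplit f u v =
    splitCount (full f (suc u)) (full f (suc v)) (leaf f u) (leaf f v) (leaf f u) (leaf f v)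

  leafSplit : ℕ → ℕ → ℕ → ℕ
  leafSplit f u v =
    splitCount (full f (suc u)) (leaf f (suc v)) (leaf f u) (trap f (suc v)) (leaf f u) (para f (suc v))

  dipSplit : ℕ → ℕ → ℕ → ℕ
  dipSplit f u v =
    splitCount (leaf f (suc u)) (leaf f (suc v)) (trap f (suc u)) (trap f (suc v))
               (para f (suc u)) (para f (suc v))

-- The symmetric splits do not depend on which half is on the left; this is
-- why the rounding choices of 1-VDA do not affect the counts.
fullSplit-comm : ∀ f u v → fullSplit f u v ≡ fullSplit f v u
fullSplit-comm f u v =
  splitCount-reverse (full f (suc u)) (full f (suc v)) (leaf f u) (leaf f v) (leaf f u) (leaf f v)

dipSplit-comm : ∀ f u v → dipSplit f u v ≡ dipSplit f v u
dipSplit-comm f u v =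
  splitCount-reverse (leaf f (suc u)) (leaf f (suc v)) (trap f (suc u)) (trap f (suc v))
                     (para f (suc u)) (para f (suc v))

-- The count of E(x_p, y_(p+n)) according to the shape of the subgraph
-- (the invalid subgraphs from p̄ or p̲ to p have count 0).
count : ℕ → Kind → Kind → ℕ → ℕ
count f basic basic n       = full f n
count f basic upper n       = leaf f n
count f basic lower n       = leaf f n
count f upper basic zero    = 0
count f upper basic (suc n) = leaf f n
count f lower basic zero    = 0
count f lower basic (suc n) = leaf f n
count f upper upper n       = trap f n
count f lower lower n       = trap f n
count f upper lower n       = para f n
count f lower upper n       = para f n

-- Count of the general rule for E(x_p, y_q) split at i = p + k, m = q - i.
splitAt : ℕ → Kind → Kind → ℕ → ℕ → ℕ
splitAt f x y k m =
  splitCount (count f x basic k) (count f basic y m) (count f x upper (k ∸ 1)) (count f upper y m)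
             (count f x lower (k ∸ 1)) (count f lower y m)

data Wing : Kind → Set where
  upper-wing : Wing upper
  lower-wing : Wing lower

splitAt-fromBasic : ∀ f {y} u v → Wing y → splitAt f basic y (suc u) (suc v) ≡ leafSplit f u v
splitAt-fromBasic f u v upper-wing = refl
splitAt-fromBasic f u v lower-wing =
  splitCount-swapRoutes (full f (suc u)) (leaf f (suc v)) (leaf f u) (para f (suc v))
                        (leaf f u) (trap f (suc v))

splitAt-toBasic : ∀ f {x} u v → Wing x → splitAt f x basic (suc (suc v)) (suc u) ≡ leafSplit f u v
splitAt-toBasic f u v upper-wing =
  splitCount-reverse (leaf f (suc v)) (full f (suc u)) (trap f (suc v)) (leaf f u)
                     (para f (suc v)) (leaf f u)
splitAt-toBasic f u v lower-wing =
  trans (splitCount-swapRoutes (leaf f (suc v)) (full f (suc u)) (para f (suc v)) (leaf f u)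
                               (trap f (suc v)) (leaf f u))
        (splitAt-toBasic f u v upper-wing)

splitAt-dipterous : ∀ f {x y} u v → Wing x → Wing y →
  splitAt f x y (suc (suc u)) (suc v) ≡ dipSplit f u v
splitAt-dipterous f u v upper-wing upper-wing = refl
splitAt-dipterous f u v upper-wing lower-wing =
  splitCount-crossRoutes (leaf f (suc u)) (leaf f (suc v)) (trap f (suc u)) (para f (suc v))
                         (para f (suc u)) (trap f (suc v))
splitAt-dipterous f u v lower-wing upper-wing =
  trans (splitCount-swapRoutes (leaf f (suc u)) (leaf f (suc v)) (para f (suc u)) (trap f (suc v))
                               (trap f (suc u)) (para f (suc v)))
        (splitAt-dipterous f u v upper-wing lower-wing)
splitAt-dipterous f u v lower-wing lower-wing =
  splitCount-swapRoutes (leaf f (suc u)) (leaf f (suc v)) (para f (suc u)) (para f (suc v))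
                        (trap f (suc u)) (trap f (suc v))

complement : ∀ {u v r} → u + v ≡ r → suc r ∸ u ≡ suc v
complement {u} {v} refl = trans (cong (_∸ u) (sym (+-suc u v))) (m+n∸m≡n u (suc v))

∸⌈/2⌉ : ∀ r → suc r ∸ ⌈ r /2⌉ ≡ suc ⌊ r /2⌋
∸⌈/2⌉ r = complement (trans (+-comm ⌈ r /2⌉ ⌊ r /2⌋) (⌊n/2⌋+⌈n/2⌉≡n r))

∸⌊/2⌋ : ∀ r → suc r ∸ ⌊ r /2⌋ ≡ suc ⌈ r /2⌉
∸⌊/2⌋ r = complement (⌊n/2⌋+⌈n/2⌉≡n r)

splitAt-full : ∀ f r up → let k = half up (suc (suc r)) in
  splitAt f basic basic k (suc (suc r) ∸ k) ≡ full (suc f) (suc (suc r))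
splitAt-full f r true  rewrite ∸⌈/2⌉ r = refl
splitAt-full f r false rewrite ∸⌊/2⌋ r = fullSplit-comm f ⌊ r /2⌋ ⌈ r /2⌉

splitAt-leafOut : ∀ f {y} r → Wing y → let k = ⌈ suc (suc r) /2⌉ in
  splitAt f basic y k (suc (suc r) ∸ k) ≡ leaf (suc f) (suc (suc r))
splitAt-leafOut f r w rewrite ∸⌈/2⌉ r = splitAt-fromBasic f ⌈ r /2⌉ ⌊ r /2⌋ w

splitAt-leafIn : ∀ f {x} r → Wing x → let k = ⌈ suc (suc (suc r)) /2⌉ in
  splitAt f x basic k (suc (suc (suc r)) ∸ k) ≡ leaf (suc f) (suc (suc r))
splitAt-leafIn f r w rewrite ∸⌊/2⌋ r = splitAt-toBasic f ⌈ r /2⌉ ⌊ r /2⌋ w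

splitAt-dipterousRounded : ∀ f {x y} r up → Wing x → Wing y →
  let k = half up (suc (suc (suc (suc r)))) in
  splitAt f x y k (suc (suc (suc r)) ∸ k) ≡ dipSplit f ⌈ r /2⌉ ⌊ r /2⌋
splitAt-dipterousRounded f r true  v w rewrite ∸⌈/2⌉ r = splitAt-dipterous f ⌈ r /2⌉ ⌊ r /2⌋ v w
splitAt-dipterousRounded f r false v w rewrite ∸⌊/2⌋ r =
  trans (splitAt-dipterous f ⌊ r /2⌋ ⌈ r /2⌉ v w) (dipSplit-comm f ⌊ r /2⌋ ⌈ r /2⌉)

CountsCorrect : Policy → ℕ → Set
CountsCorrect pol f = ∀ x p y n → literals (vda pol f x p y n) ≡ count f x y n

literals-split : ∀ {pol f} → CountsCorrect pol f → ∀ x p y k m →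
  splitCount (literals (vda pol f x p basic k)) (literals (vda pol f basic (p + k) y m))
             (literals (vda pol f x p upper (k ∸ 1))) (literals (vda pol f upper (p + k) y m))
             (literals (vda pol f x p lower (k ∸ 1))) (literals (vda pol f lower (p + k) y m))
  ≡ splitAt f x y k m
literals-split ih x p y k m
  rewrite ih x p basic k | ih basic (p + k) y m | ih x p upper (k ∸ 1) | ih upper (p + k) y m
        | ih x p lower (k ∸ 1) | ih lower (p + k) y m = refl

countsCorrect-zero : ∀ pol → CountsCorrect pol zero
countsCorrect-zero pol basic p basic n       = refl
countsCorrect-zero pol basic p upper n       = refl
countsCorrect-zero pol basic p lower n       = refl
countsCorrect-zero pol upper p basic zero    = refl
countsCorrect-zero pol upper p basic (suc n) = refl
countsCorrect-zero pol lower p basic zero    = refl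
countsCorrect-zero pol lower p basic (suc n) = refl
countsCorrect-zero pol upper p upper n       = refl
countsCorrect-zero pol upper p lower n       = refl
countsCorrect-zero pol lower p upper n       = refl
countsCorrect-zero pol lower p lower n       = refl

countsCorrect-suc : ∀ pol f → CountsCorrect pol f → CountsCorrect pol (suc f)
countsCorrect-suc pol f ih = go
  where
  split : ∀ x p y n k {c} → splitAt f x y k (n ∸ k) ≡ c →
    splitCount (literals (vda pol f x p basic k)) (literals (vda pol f basic (p + k) y (n ∸ k)))
               (literals (vda pol f x p upper (k ∸ 1))) (literals (vda pol f upper (p + k) y (n ∸ k)))
               (literals (vda pol f x p lower (k ∸ 1))) (literals (vda pol f lower (p + k) y (n ∸ k)))
    ≡ c
  split x p y n k = trans (literals-split ih x p y k (n ∸ k))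

  go : CountsCorrect pol (suc f)
  go basic p basic zero                      = refl
  go basic p basic (suc zero)                = refl
  go basic p basic n@(suc (suc r))           =
    split basic p basic n _ (splitAt-full f r (pol basic p basic (p + n)))
  go basic p upper zero                      = refl
  go basic p upper (suc zero)                = refl
  go basic p upper n@(suc (suc r))           = split basic p upper n _ (splitAt-leafOut f r upper-wing)
  go basic p lower zero                      = refl
  go basic p lower (suc zero)                = refl
  go basic p lower n@(suc (suc r))           = split basic p lower n _ (splitAt-leafOut f r lower-wing)
  go upper p basic zero                      = refl
  go upper p basic (suc zero)                = refl
  go upper p basic (suc (suc zero))          = refl
  go upper p basic n@(suc (suc (suc r)))     = split upper p basic n _ (splitAt-leafIn f r upper-wing)
  go lower p basic zero                      = refl
  go lower p basic (suc zero)                = refl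
  go lower p basic (suc (suc zero))          = refl
  go lower p basic n@(suc (suc (suc r)))     = split lower p basic n _ (splitAt-leafIn f r lower-wing)
  go upper p upper zero                      = refl
  go upper p upper (suc zero)                = refl
  go upper p upper (suc (suc zero))          = refl
  go upper p upper n@(suc (suc (suc r)))     =
    split upper p upper n _ (splitAt-dipterousRounded f r (pol upper p upper (p + n)) upper-wing upper-wing)
  go upper p lower zero                      = refl
  go upper p lower (suc zero)                = refl
  go upper p lower (suc (suc zero))          = refl
  go upper p lower n@(suc (suc (suc r)))     =
    split upper p lower n _ (splitAt-dipterousRounded f r (pol upper p lower (p + n)) upper-wing lower-wing)
  go lower p upper zero                      = refl
  go lower p upper (suc zero)                = refl
  go lower p upper (suc (suc zero))          = refl
  go lower p upper n@(suc (suc (suc r)))     =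
    split lower p upper n _ (splitAt-dipterousRounded f r (pol lower p upper (p + n)) lower-wing upper-wing)
  go lower p lower zero                      = refl
  go lower p lower (suc zero)                = refl
  go lower p lower (suc (suc zero))          = refl
  go lower p lower n@(suc (suc (suc r)))     =
    split lower p lower n _ (splitAt-dipterousRounded f r (pol lower p lower (p + n)) lower-wing lower-wing)

countsCorrect : ∀ pol f → CountsCorrect pol f
countsCorrect pol zero    = countsCorrect-zero pol
countsCorrect pol (suc f) = countsCorrect-suc pol f (countsCorrect pol f)

-- For n = 3 + r, both trapezoidal and parallelogram counts are
-- dipSplit n ⌈ r /2⌉ ⌊ r /2⌋, so the four literal counts coincide.
lemma1 : (pol : Policy) (p n : ℕ) → 1 ≤ p → 2 < n →
    (literals (VDA pol upper p upper n) ≡ literals (VDA pol lower p upper n))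
    × (literals (VDA pol upper p upper n) ≡ literals (VDA pol upper p lower n))
    × (literals (VDA pol lower p lower n) ≡ literals (VDA pol lower p upper n))
    × (literals (VDA pol lower p lower n) ≡ literals (VDA pol upper p lower n))
lemma1 pol p (suc zero)       _ (s≤s ())
lemma1 pol p (suc (suc zero)) _ (s≤s (s≤s ()))
lemma1 pol p n@(suc (suc (suc r))) _ _ =
    trans uu (sym lu) , trans uu (sym ul) , trans ll (sym lu) , trans ll (sym ul)
  where
  uu : literals (VDA pol upper p upper n) ≡ dipSplit n ⌈ r /2⌉ ⌊ r /2⌋
  uu = countsCorrect pol (suc n) upper p upper n
  ll : literals (VDA pol lower p lower n) ≡ dipSplit n ⌈ r /2⌉ ⌊ r /2⌋
  ll = countsCorrect pol (suc n) lower p lower n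
  ul : literals (VDA pol upper p lower n) ≡ dipSplit n ⌈ r /2⌉ ⌊ r /2⌋
  ul = countsCorrect pol (suc n) upper p lower n
  lu : literals (VDA pol lower p upper n) ≡ dipSplit n ⌈ r /2⌉ ⌊ r /2⌋
  lu = countsCorrect pol (suc n) lower p upper n
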